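{- Let $\mathcal P$ be a $\mathrm{DynQF}^*$ program with nesting depth $k$ and let $l$ be a natural number. Let $\mathcal S$ and $\mathcal T$ be states of $\mathcal P$ with domains $S$ and $T$, and let $A\subseteq S$, $B\subseteq T$. There is a number $m\in\mathbb N$ such that if $A\approx_m^{\pi,\mathcal S,\mathcal T}B$, then $A\approx_0^{\pi,P_\alpha(\mathcal S),P_\beta(\mathcal T)}B$ for all $\pi$-respecting modification sequences $\alpha$ on $A$ and $\beta$ on $B$ of length at most $l$.
   Context: Dynamic setting ($\mathrm{DynQF}^*$): a relational input schema, an auxiliary schema and a built-in schema, the latter two may contain relation and function symbols (of arbitrary arity); constants are allowed. Update terms: variables and constants; $f(t_1,\dots,t_k)$ for function symbols $f$; $\mathrm{ite}(\phi,t_1,t_2)$ for a quantifier-free formula $\phi$ (possibly using update terms), evaluating to $t_1$ if $\phi$ holds and $t_2$ otherwise. The program has, for each auxiliary relation symbol $R$ and abstract modification $\delta$ (insertion/deletion into an input relation), a quantifier-free formula $\varphi^R_\delta(\vec x;\vec y)$ (possibly using update terms) and for each auxiliary function symbol $f$ an update term $t^f_\delta(\vec x;\vec y)$. $P_{\delta(\vec a)}(\mathcal S)$ is the state where the input is modified by $\delta(\vec a)$, each auxiliary $R$ becomes $\{\vec b:\mathcal S\models\varphi^R_\delta(\vec a;\vec b)\}$, each auxiliary $f$ becomes $\vec b\mapsto$ value of $t^f_\delta(\vec a;\vec b)$ in $\mathcal S$, built-in data unchanged; $P_\alpha$ is iterated application. Nesting depth: $d(x)=0$ for variables (and constants); $d(f(t_1,\dots,t_k))=\max_i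 d(t_i)+1$; $d(\mathrm{ite}(\phi,t_1,t_2))=\max\{d(\phi),d(t_1),d(t_2)\}$; $d(\phi)$ is the maximal depth of terms in $\phi$; the nesting depth of $\mathcal P$ is the maximal depth of any update term in it. $\mathrm{Terms}(\sigma,k)$ is the set of terms of nesting depth at most $k$ with function symbols from $\sigma$. The $k$-neighborhood $N_k^{\mathcal S}(A)$ of $A\subseteq S$ is the set of values in $\mathcal S$ of terms $t\in\mathrm{Terms}(\tau,k)$ ($\tau$ the full schema) under assignments of their variables to elements of $A$. $A\subseteq S$ and $B\subseteq T$ are $k$-similar via $\pi$ in $\mathcal S,\mathcal T$, written $A\approx_k^{\pi,\mathcal S,\mathcal T}B$, if $\pi:N_k^{\mathcal S}(A)\to N_k^{\mathcal T}(B)$ is a bijection such that its restriction to $A$ is a bijection onto $B$, $\pi(t^{\mathcal S}(\vec a))=t^{\mathcal T}(\pi(\vec a))$ for all terms $t\in\mathrm{Terms}(\tau,k)$ and tuples $\vec a$ over $A$, and $\pi$ preserves all relation symbols on $N_k^{\mathcal S}(A)$. A modification sequence is on $A$ if all modified tuples are over $A$; sequences $\delta_1(\vec a_1)\cdots\delta_r(\vec a_r)$ and $\delta'_1(\vec b_1)\cdots\delta'_r(\vec b_r)$ are $\pi$-respecting if $\delta_i=\delta'_i$ as abstract modifications and $\vec b_i=\pi(\vec a_i)$ for all $i$. -}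

module Defs where

open import Data.Nat using (ℕ; zero; suc; _⊔_; _≤_)
open import Data.Fin using (Fin; _≟_)
open import Data.Fin.Subset using (Subset; _∈_)
open import Data.Vec using (Vec; []; _∷_; map; lookup)
open import Data.Vec.Properties using (≡-dec)
open import Data.Bool using (Bool; true; false; if_then_else_; _∧_; _∨_; not)
open import Data.Sum using (_⊎_; inj₁; inj₂; [_,_])
open import Data.Product using (Σ; _×_; _,_)
open import Data.List using (List; []; _∷_; length)
open import Data.List.Relation.Unary.All using (All)
open import Relation.Binary.PropositionalEquality using (_≡_; refl)
open import Relation.Nullary using (yes; no)
open import Relation.Nullary.Decidable using (⌊_⌋)
open import Function using (_∘_)

-- The input schema is relational; auxiliary and built-in schemas contain
-- relation and function symbols of arbitrary arity (constants = 0-ary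
-- function symbols).

record DynSchema : Set where
  field
    nIn    : ℕ
    inAr   : Fin nIn → ℕ
    nAuxR  : ℕ
    auxRAr : Fin nAuxR → ℕ
    nAuxF  : ℕ
    auxFAr : Fin nAuxF → ℕ
    nBiR   : ℕ
    biRAr  : Fin nBiR → ℕ
    nBiF   : ℕ
    biFAr  : Fin nBiF → ℕ

module _ (σ : DynSchema) where
  open DynSchema σ

  data RelSym : Set where
    inR  : Fin nIn → RelSym
    auxR : Fin nAuxR → RelSym
    biR  : Fin nBiR → RelSym

  data FunSym : Set where
    auxF : Fin nAuxF → FunSym
    biF  : Fin nBiF → FunSym

  rAr : RelSym → ℕ
  rAr (inR r)  = inAr r
  rAr (auxR r) = auxRAr r
  rAr (biR r)  = biRAr r

  fAr : FunSym → ℕ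
  fAr (auxF f) = auxFAr f
  fAr (biF f)  = biFAr f

  record State (n : ℕ) : Set where
    field
      inp    : (r : Fin nIn) → Vec (Fin n) (inAr r) → Bool
      auxRel : (r : Fin nAuxR) → Vec (Fin n) (auxRAr r) → Bool
      auxFun : (f : Fin nAuxF) → Vec (Fin n) (auxFAr f) → Fin n
      biRel  : (r : Fin nBiR) → Vec (Fin n) (biRAr r) → Bool
      biFun  : (f : Fin nBiF) → Vec (Fin n) (biFAr f) → Fin n

  relI : ∀ {n} → State n → (R : RelSym) → Vec (Fin n) (rAr R) → Bool
  relI S (inR r)  = State.inp S r
  relI S (auxR r) = State.auxRel S r
  relI S (biR r)  = State.biRel S r

  funI : ∀ {n} → State n → (f : FunSym) → Vec (Fin n) (fAr f) → Fin n
  funI S (auxF f) = State.auxFun S f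
  funI S (biF f)  = State.biFun S f

  data FOTerm (V : Set) : Set where
    var : V → FOTerm V
    app : (f : FunSym) → Vec (FOTerm V) (fAr f) → FOTerm V

  mutual
    evalT : ∀ {n V} → State n → (V → Fin n) → FOTerm V → Fin n
    evalT S ρ (var x)    = ρ x
    evalT S ρ (app f ts) = funI S f (evalTs S ρ ts)

    evalTs : ∀ {n V m} → State n → (V → Fin n) → Vec (FOTerm V) m → Vec (Fin n) m
    evalTs S ρ []       = []
    evalTs S ρ (t ∷ ts) = evalT S ρ t ∷ evalTs S ρ ts

  -- nesting depth: variables and constants have depth 0,
  -- d(f(t1..tk)) = max d(ti) + 1 for k ≥ 1
  mutual
    depthT : ∀ {V} → FOTerm V → ℕ
    depthT (var x)    = 0
    depthT (app f ts) = depthArgs ts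

    depthArgs : ∀ {V m} → Vec (FOTerm V) m → ℕ
    depthArgs []       = 0
    depthArgs (t ∷ ts) = suc (depthT t ⊔ depthTs ts)

    depthTs : ∀ {V m} → Vec (FOTerm V) m → ℕ
    depthTs []       = 0
    depthTs (t ∷ ts) = depthT t ⊔ depthTs ts

  data UTerm (V : Set) : Set
  data UForm (V : Set) : Set

  data UTerm V where
    uvar : V → UTerm V
    uapp : (f : FunSym) → Vec (UTerm V) (fAr f) → UTerm V
    ite  : UForm V → UTerm V → UTerm V → UTerm V

  data UForm V where
    rel  : (R : RelSym) → Vec (UTerm V) (rAr R) → UForm V
    eq   : UTerm V → UTerm V → UForm V
    tru  : UForm V
    fls  : UForm V
    neg  : UForm V → UForm V
    conj : UForm V → UForm V → UForm V
    disj : UForm V → UForm V → UForm V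

  mutual
    evalU : ∀ {n V} → State n → (V → Fin n) → UTerm V → Fin n
    evalU S ρ (uvar x)     = ρ x
    evalU S ρ (uapp f ts)  = funI S f (evalUs S ρ ts)
    evalU S ρ (ite φ t t') = if evalF S ρ φ then evalU S ρ t else evalU S ρ t'

    evalUs : ∀ {n V m} → State n → (V → Fin n) → Vec (UTerm V) m → Vec (Fin n) m
    evalUs S ρ []       = []
    evalUs S ρ (t ∷ ts) = evalU S ρ t ∷ evalUs S ρ ts

    evalF : ∀ {n V} → State n → (V → Fin n) → UForm V → Bool
    evalF S ρ (rel R ts) = relI S R (evalUs S ρ ts)
    evalF S ρ (eq t t')  = ⌊ evalU S ρ t ≟ evalU S ρ t' ⌋
    evalF S ρ tru        = true
    evalF S ρ fls        = false
    evalF S ρ (neg φ)    = not (evalF S ρ φ)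
    evalF S ρ (conj φ ψ) = evalF S ρ φ ∧ evalF S ρ ψ
    evalF S ρ (disj φ ψ) = evalF S ρ φ ∨ evalF S ρ ψ

  mutual
    depthU : ∀ {V} → UTerm V → ℕ
    depthU (uvar x)     = 0
    depthU (uapp f ts)  = depthUArgs ts
    depthU (ite φ t t') = depthF φ ⊔ depthU t ⊔ depthU t'

    depthUArgs : ∀ {V m} → Vec (UTerm V) m → ℕ
    depthUArgs []       = 0
    depthUArgs (t ∷ ts) = suc (depthU t ⊔ depthUs ts)

    depthUs : ∀ {V m} → Vec (UTerm V) m → ℕ
    depthUs []       = 0
    depthUs (t ∷ ts) = depthU t ⊔ depthUs ts

    depthF : ∀ {V} → UForm V → ℕ
    depthF (rel R ts) = depthUs ts
    depthF (eq t t')  = depthU t ⊔ depthU t'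
    depthF tru        = 0
    depthF fls        = 0
    depthF (neg φ)    = depthF φ
    depthF (conj φ ψ) = depthF φ ⊔ depthF ψ
    depthF (disj φ ψ) = depthF φ ⊔ depthF ψ

  data AbsMod : Set where
    ins : Fin nIn → AbsMod
    del : Fin nIn → AbsMod

  modAr : AbsMod → ℕ
  modAr (ins r) = inAr r
  modAr (del r) = inAr r

  -- φ^R_δ(x⃗; y⃗) and t^f_δ(x⃗; y⃗): inj₁ = x-variables, inj₂ = y-variables
  record Program : Set where
    field
      φ : (δ : AbsMod) (R : Fin nAuxR) → UForm (Fin (modAr δ) ⊎ Fin (auxRAr R))
      t : (δ : AbsMod) (f : Fin nAuxF) → UTerm (Fin (modAr δ) ⊎ Fin (auxFAr f))

  maxFin : (n : ℕ) → (Fin n → ℕ) → ℕ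
  maxFin zero    g = 0
  maxFin (suc n) g = g Fin.zero ⊔ maxFin n (g ∘ Fin.suc)

  progDepth : Program → ℕ
  progDepth P =
    maxFin nIn (λ r →
      maxFin nAuxR (λ R → depthF (Program.φ P (ins r) R) ⊔ depthF (Program.φ P (del r) R))
      ⊔ maxFin nAuxF (λ f → depthU (Program.t P (ins r) f) ⊔ depthU (Program.t P (del r) f)))

  Mod : ℕ → Set
  Mod n = Σ AbsMod (λ δ → Vec (Fin n) (modAr δ))

  updIns : ∀ {n} → ((r : Fin nIn) → Vec (Fin n) (inAr r) → Bool) → (r : Fin nIn) → Vec (Fin n) (inAr r) →
           (r' : Fin nIn) → Vec (Fin n) (inAr r') → Bool
  updIns I r a r' b with r' ≟ r
  ... | yes refl = I r' b ∨ ⌊ ≡-dec _≟_ b a ⌋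
  ... | no _     = I r' b

  updDel : ∀ {n} → ((r : Fin nIn) → Vec (Fin n) (inAr r) → Bool) → (r : Fin nIn) → Vec (Fin n) (inAr r) →
           (r' : Fin nIn) → Vec (Fin n) (inAr r') → Bool
  updDel I r a r' b with r' ≟ r
  ... | yes refl = I r' b ∧ not ⌊ ≡-dec _≟_ b a ⌋
  ... | no _     = I r' b

  newInp : ∀ {n} → State n → (δ : AbsMod) → Vec (Fin n) (modAr δ) →
           (r : Fin nIn) → Vec (Fin n) (inAr r) → Bool
  newInp S (ins r) a = updIns (State.inp S) r a
  newInp S (del r) a = updDel (State.inp S) r a

  applyMod : ∀ {n} → Program → Mod n → State n → State n
  applyMod P (δ , a) S = record
    { inp    = newInp S δ a
    ; auxRel = λ R b → evalF S [ lookup a , lookup b ] (Program.φ P δ R)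
    ; auxFun = λ f b → evalU S [ lookup a , lookup b ] (Program.t P δ f)
    ; biRel  = State.biRel S
    ; biFun  = State.biFun S
    }

  run : ∀ {n} → Program → List (Mod n) → State n → State n
  run P []      S = S
  run P (m ∷ α) S = run P α (applyMod P m S)

  OnSet : ∀ {n} → Subset n → List (Mod n) → Set
  OnSet A α = All (λ m → ∀ i → lookup (Σ.proj₂ m) i ∈ A) α

  mapMod : ∀ {n n'} → (Fin n → Fin n') → Mod n → Mod n'
  mapMod π (δ , a) = δ , map π a

  Respecting : ∀ {n n'} → (Fin n → Fin n') → List (Mod n) → List (Mod n') → Set
  Respecting π α β = β ≡ Data.List.map (mapMod π) α

  InN : ∀ {n} → ℕ → State n → Subset n → Fin n → Set
  InN {n} k S A x =
    Σ ℕ λ v → Σ (FOTerm (Fin v)) λ t → depthT t ≤ k ×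
      Σ (Fin v → Fin n) λ ρ → (∀ i → ρ i ∈ A) × evalT S ρ t ≡ x

  -- A ≈_k^{π,S,T} B.  π is given as a function on the whole domain; only
  -- its restriction to N_k^S(A) is constrained.
  record Similar {nS nT : ℕ} (k : ℕ) (π : Fin nS → Fin nT)
                 (S : State nS) (T : State nT) (A : Subset nS) (B : Subset nT) : Set where
    field
      nbhd-into : ∀ x → InN k S A x → InN k T B (π x)
      nbhd-inj  : ∀ x y → InN k S A x → InN k S A y → π x ≡ π y → x ≡ y
      nbhd-onto : ∀ y → InN k T B y → Σ (Fin nS) λ x → InN k S A x × π x ≡ y
      A-into    : ∀ a → a ∈ A → π a ∈ B
      A-onto    : ∀ b → b ∈ B → Σ (Fin nS) λ a → a ∈ A × π a ≡ b
      terms     : ∀ v (t : FOTerm (Fin v)) → depthT t ≤ k →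
                  (ρ : Fin v → Fin nS) → (∀ i → ρ i ∈ A) →
                  π (evalT S ρ t) ≡ evalT T (π ∘ ρ) t
      rels      : ∀ (R : RelSym) (c : Vec (Fin nS) (rAr R)) →
                  (∀ i → InN k S A (lookup c i)) →
                  relI S R c ≡ relI T R (map π c)

-- A modification P_δ(a⃗) with a⃗ over A looks only a bounded distance into
-- the old state: an element of the j-neighbourhood of A in P_δ(a⃗)(S) is
-- built from a⃗ and elements of smaller neighbourhoods by update terms of
-- depth ≤ k, so it lies in the h(j)-neighbourhood of A in S for an h
-- depending only on j and k.  Hence if π respects functions, relations and
-- equality on a large enough neighbourhood before the modification, the
-- update terms and formulas evaluate identically on both sides, and π still
-- respects them on the j-neighbourhood afterwards.  Iterating l times gives
-- an m depending only on k and l.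

module Submission where

open import Defs
open import Data.Nat using (ℕ; zero; suc; _≤_; _+_; _⊔_; pred; z≤n; s≤s)
open import Data.Nat.Properties
  using (≤-refl; ≤-trans; ≤-reflexive; n≤1+n; m≤n⇒m≤1+n; m≤m+n; m≤n+m; +-suc; +-monoʳ-≤;
         m≤m⊔n; m≤n⊔m; m⊔n≤o⇒m≤o; m⊔n≤o⇒n≤o; ⊔-lub)
open import Data.Fin using (Fin; _≟_) renaming (zero to fzero; suc to fsuc)
open import Data.Fin.Properties using (any?)
open import Data.Fin.Subset using (Subset; _∈_)
open import Data.Fin.Subset.Properties using (_∈?_)
open import Data.Vec using (Vec; []; _∷_; map; lookup)
open import Data.Vec.Properties using (lookup-map; ∷-injective)
open import Data.Bool using (true; false; if_then_else_; _∧_; _∨_; not)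
open import Data.Bool.Properties using (if-float)
open import Data.Sum using (inj₁; inj₂; [_,_])
open import Data.Product using (Σ; _×_; _,_; proj₁; proj₂)
open import Data.List using (List; []; _∷_; length)
open import Data.List.Relation.Unary.All using (_∷_)
open import Data.Empty using (⊥-elim)
open import Function using (_∘_)
open import Function.Bundles using (_⇔_; mk⇔)
open import Relation.Binary.PropositionalEquality
  using (_≡_; refl; sym; trans; cong; cong₂; subst; module ≡-Reasoning)
open import Relation.Nullary using (Dec; yes; no; does)
open import Relation.Nullary.Decidable using (⌊_⌋; isYes≗does; does-⇔)

⌊⌋-⇔ : {X Y : Set} → X ⇔ Y → (x? : Dec X) (y? : Dec Y) → ⌊ x? ⌋ ≡ ⌊ y? ⌋
⌊⌋-⇔ X⇔Y x? y? = begin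
  ⌊ x? ⌋   ≡⟨ isYes≗does x? ⟩
  does x?  ≡⟨ does-⇔ X⇔Y x? y? ⟩
  does y?  ≡⟨ isYes≗does y? ⟨
  ⌊ y? ⌋   ∎
  where open ≡-Reasoning

InjectiveOn : {X Y : Set} → (X → Set) → (X → Y) → Set
InjectiveOn G f = ∀ {x y} → G x → G y → f x ≡ f y → x ≡ y

map-injectiveOn : ∀ {X Y : Set} {G : X → Set} {f : X → Y} {m} → InjectiveOn G f →
                  (c c′ : Vec X m) → (∀ i → G (lookup c i)) → (∀ i → G (lookup c′ i)) →
                  map f c ≡ map f c′ → c ≡ c′
map-injectiveOn inj []      []        _   _    _  = refl
map-injectiveOn inj (x ∷ c) (x′ ∷ c′) c∈G c′∈G fc≡fc′ =
  cong₂ _∷_ (inj (c∈G fzero) (c′∈G fzero) (proj₁ (∷-injective fc≡fc′)))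
            (map-injectiveOn inj c c′ (c∈G ∘ fsuc) (c′∈G ∘ fsuc) (proj₂ (∷-injective fc≡fc′)))

-- Bounds the depth of f(t₁,…,tₘ) when every tᵢ has depth ≤ j; constants have depth 0.
appDepth : ℕ → ℕ → ℕ
appDepth zero    j = 0
appDepth (suc m) j = suc j

appDepth-≤ : ∀ m j → appDepth m j ≤ suc j
appDepth-≤ zero    j = z≤n
appDepth-≤ (suc m) j = ≤-refl

module _ (σ : DynSchema) where
  open DynSchema σ

  InN-mono : ∀ {n d e} {S : State σ n} {A : Subset n} {x} → d ≤ e → InN σ d S A x → InN σ e S A x
  InN-mono d≤e (v , t , dt≤d , ρ , ρ∈A , t≡x) = v , t , ≤-trans dt≤d d≤e , ρ , ρ∈A , t≡x

  ∈⇒InN : ∀ {n d} {S : State σ n} {A : Subset n} {x} → x ∈ A → InN σ d S A x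
  ∈⇒InN {x = x} x∈A = 1 , var fzero , z≤n , (λ _ → x) , (λ _ → x∈A) , refl

  InN-appDepth : ∀ {n m j} {S : State σ n} {A : Subset n} (c : Vec (Fin n) m) →
                 (∀ i → InN σ j S A (lookup c i)) → ∀ i → InN σ (appDepth m j) S A (lookup c i)
  InN-appDepth (x ∷ c) c∈N i = InN-mono (n≤1+n _) (c∈N i)

  depthArgs-≤ : ∀ {V m j} (ts : Vec (FOTerm σ V) m) → depthTs σ ts ≤ j → depthArgs σ ts ≤ appDepth m j
  depthArgs-≤ []       _  = z≤n
  depthArgs-≤ (t ∷ ts) le = s≤s le

  depthTs-≤-pred : ∀ {V m j} (ts : Vec (FOTerm σ V) m) → depthArgs σ ts ≤ j → depthTs σ ts ≤ pred j
  depthTs-≤-pred []       _        = z≤n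
  depthTs-≤-pred (t ∷ ts) (s≤s le) = le

  depthUs-≤-depthUArgs : ∀ {V m} (ts : Vec (UTerm σ V) m) → depthUs σ ts ≤ depthUArgs σ ts
  depthUs-≤-depthUArgs []       = z≤n
  depthUs-≤-depthUArgs (t ∷ ts) = n≤1+n _

  appDepth-+ : ∀ {V m} d (ts : Vec (UTerm σ V) m) → appDepth m (d + depthUs σ ts) ≤ d + depthUArgs σ ts
  appDepth-+ d []       = z≤n
  appDepth-+ d (t ∷ ts) = ≤-reflexive (sym (+-suc d _))

  mutual
    rename : ∀ {V W} → (V → W) → FOTerm σ V → FOTerm σ W
    rename s (var x)    = var (s x)
    rename s (app f ts) = app f (renames s ts)

    renames : ∀ {V W m} → (V → W) → Vec (FOTerm σ V) m → Vec (FOTerm σ W) m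
    renames s []       = []
    renames s (t ∷ ts) = rename s t ∷ renames s ts

  mutual
    depthT-rename : ∀ {V W} (s : V → W) (t : FOTerm σ V) → depthT σ (rename s t) ≡ depthT σ t
    depthT-rename s (var x)    = refl
    depthT-rename s (app f ts) = depthArgs-renames s ts

    depthArgs-renames : ∀ {V W m} (s : V → W) (ts : Vec (FOTerm σ V) m) →
                        depthArgs σ (renames s ts) ≡ depthArgs σ ts
    depthArgs-renames s []       = refl
    depthArgs-renames s (t ∷ ts) = cong suc (depthTs-renames s (t ∷ ts))

    depthTs-renames : ∀ {V W m} (s : V → W) (ts : Vec (FOTerm σ V) m) →
                      depthTs σ (renames s ts) ≡ depthTs σ ts
    depthTs-renames s []       = refl
    depthTs-renames s (t ∷ ts) = cong₂ _⊔_ (depthT-rename s t) (depthTs-renames s ts)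

  mutual
    evalT-cong : ∀ {n V} (S : State σ n) {ρ ρ′ : V → Fin n} → (∀ x → ρ x ≡ ρ′ x) →
                 (t : FOTerm σ V) → evalT σ S ρ t ≡ evalT σ S ρ′ t
    evalT-cong S ρ≗ρ′ (var x)    = ρ≗ρ′ x
    evalT-cong S ρ≗ρ′ (app f ts) = cong (funI σ S f) (evalTs-cong S ρ≗ρ′ ts)

    evalTs-cong : ∀ {n V m} (S : State σ n) {ρ ρ′ : V → Fin n} → (∀ x → ρ x ≡ ρ′ x) →
                  (ts : Vec (FOTerm σ V) m) → evalTs σ S ρ ts ≡ evalTs σ S ρ′ ts
    evalTs-cong S ρ≗ρ′ []       = refl
    evalTs-cong S ρ≗ρ′ (t ∷ ts) = cong₂ _∷_ (evalT-cong S ρ≗ρ′ t) (evalTs-cong S ρ≗ρ′ ts)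

  mutual
    evalT-rename : ∀ {n V W} (S : State σ n) (ρ : W → Fin n) (s : V → W) (t : FOTerm σ V) →
                   evalT σ S ρ (rename s t) ≡ evalT σ S (ρ ∘ s) t
    evalT-rename S ρ s (var x)    = refl
    evalT-rename S ρ s (app f ts) = cong (funI σ S f) (evalTs-renames S ρ s ts)

    evalTs-renames : ∀ {n V W m} (S : State σ n) (ρ : W → Fin n) (s : V → W) (ts : Vec (FOTerm σ V) m) →
                     evalTs σ S ρ (renames s ts) ≡ evalTs σ S (ρ ∘ s) ts
    evalTs-renames S ρ s []       = refl
    evalTs-renames S ρ s (t ∷ ts) = cong₂ _∷_ (evalT-rename S ρ s t) (evalTs-renames S ρ s ts)

  record Enumeration {n} (A : Subset n) : Set where
    field
      size       : ℕ
      elem       : Fin size → Fin n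
      elem∈      : ∀ i → elem i ∈ A
      index      : ∀ {a} → a ∈ A → Fin size
      elem-index : ∀ {a} (a∈A : a ∈ A) → elem (index a∈A) ≡ a

  enumerate : ∀ {n} (A : Subset n) → Enumeration A
  enumerate {n} A with any? (_∈? A)
  ... | no A-empty = record
    { size = 0 ; elem = λ () ; elem∈ = λ () ; index = λ a∈A → ⊥-elim (A-empty (_ , a∈A)) ; elem-index = λ a∈A → ⊥-elim (A-empty (_ , a∈A)) }
  ... | yes (a₀ , a₀∈A) = record
    { size = n ; elem = elem ; elem∈ = elem∈ ; index = λ {a} _ → a ; elem-index = elem-index }
    where
      elem : Fin n → Fin n
      elem i with i ∈? A
      ... | yes _ = i
      ... | no  _ = a₀

      elem∈ : ∀ i → elem i ∈ A
      elem∈ i with i ∈? A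
      ... | yes i∈A = i∈A
      ... | no  _   = a₀∈A

      elem-index : ∀ {a} → a ∈ A → elem a ≡ a
      elem-index {a} a∈A with a ∈? A
      ... | yes _  = refl
      ... | no a∉A = ⊥-elim (a∉A a∈A)

  -- The neighbourhood is defined with an arbitrary variable set for each
  -- term; to build f(t₁,…,tₘ) from witnesses for the tᵢ we rewrite all of
  -- them over one fixed enumeration of A.
  module _ {n} (S : State σ n) (A : Subset n) where
    open Enumeration (enumerate A)

    InN⇒term : ∀ {j x} → InN σ j S A x → Σ (FOTerm σ (Fin size)) λ t → depthT σ t ≤ j × evalT σ S elem t ≡ x
    InN⇒term (v , t , dt≤j , ρ , ρ∈A , t≡x) =
      rename s t ,
      subst (_≤ _) (sym (depthT-rename s t)) dt≤j ,
      trans (evalT-rename S elem s t) (trans (evalT-cong S (λ y → elem-index (ρ∈A y)) t) t≡x)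
      where
        s : Fin v → Fin size
        s y = index (ρ∈A y)

    InN⇒terms : ∀ {j m} (c : Vec (Fin n) m) → (∀ i → InN σ j S A (lookup c i)) →
                Σ (Vec (FOTerm σ (Fin size)) m) λ ts → depthTs σ ts ≤ j × evalTs σ S elem ts ≡ c
    InN⇒terms []      _   = [] , z≤n , refl
    InN⇒terms (x ∷ c) c∈N with InN⇒term (c∈N fzero) | InN⇒terms c (c∈N ∘ fsuc)
    ... | t , dt≤j , t≡x | ts , dts≤j , ts≡c = t ∷ ts , ⊔-lub dt≤j dts≤j , cong₂ _∷_ t≡x ts≡c

    funI-InN : ∀ {j} (f : FunSym σ) (c : Vec (Fin n) (fAr σ f)) → (∀ i → InN σ j S A (lookup c i)) →
               InN σ (appDepth (fAr σ f) j) S A (funI σ S f c)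
    funI-InN f c c∈N with InN⇒terms c c∈N
    ... | ts , dts≤j , ts≡c = size , app f ts , depthArgs-≤ ts dts≤j , elem , elem∈ , cong (funI σ S f) ts≡c

    mutual
      evalU-InN : ∀ {V d} (ρ : V → Fin n) → (∀ x → InN σ d S A (ρ x)) →
                  (u : UTerm σ V) → InN σ (d + depthU σ u) S A (evalU σ S ρ u)
      evalU-InN {d = d} ρ ρ∈N (uvar x)     = InN-mono (m≤m+n d 0) (ρ∈N x)
      evalU-InN {d = d} ρ ρ∈N (uapp f ts)  =
        InN-mono (appDepth-+ d ts) (funI-InN f (evalUs σ S ρ ts) (evalUs-InN ρ ρ∈N ts))
      evalU-InN {d = d} ρ ρ∈N (ite φ t t′) with evalF σ S ρ φ
      ... | true  = InN-mono (+-monoʳ-≤ d (≤-trans (m≤n⊔m (depthF σ φ) _) (m≤m⊔n _ (depthU σ t′))))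
                             (evalU-InN ρ ρ∈N t)
      ... | false = InN-mono (+-monoʳ-≤ d (m≤n⊔m (depthF σ φ ⊔ depthU σ t) _)) (evalU-InN ρ ρ∈N t′)

      evalUs-InN : ∀ {V d m} (ρ : V → Fin n) → (∀ x → InN σ d S A (ρ x)) →
                   (ts : Vec (UTerm σ V) m) → ∀ i → InN σ (d + depthUs σ ts) S A (lookup (evalUs σ S ρ ts) i)
      evalUs-InN {d = d} ρ ρ∈N (t ∷ ts) fzero    = InN-mono (+-monoʳ-≤ d (m≤m⊔n _ _)) (evalU-InN ρ ρ∈N t)
      evalUs-InN {d = d} ρ ρ∈N (t ∷ ts) (fsuc i) = InN-mono (+-monoʳ-≤ d (m≤n⊔m _ _)) (evalUs-InN ρ ρ∈N ts i)

  -- The one-step analogue of `Similar`: π need only commute with a single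
  -- function application to arguments in N_e.  It is implied by
  -- `Similar (1 + e)`, and at e = 0 it gives back `Similar 0`; unlike
  -- `Similar`, it survives a modification with a controlled loss of depth.
  record LocalIso (e : ℕ) {nS nT : ℕ} (π : Fin nS → Fin nT)
                  (S : State σ nS) (T : State σ nT) (A : Subset nS) (B : Subset nT) : Set where
    field
      A-into   : ∀ a → a ∈ A → π a ∈ B
      A-onto   : ∀ b → b ∈ B → Σ (Fin nS) λ a → a ∈ A × π a ≡ b
      nbhd-inj : InjectiveOn (InN σ e S A) π
      funs     : ∀ (f : FunSym σ) (c : Vec (Fin nS) (fAr σ f)) → (∀ i → InN σ e S A (lookup c i)) →
                 π (funI σ S f c) ≡ funI σ T f (map π c)
      rels     : ∀ (R : RelSym σ) (c : Vec (Fin nS) (rAr σ R)) → (∀ i → InN σ e S A (lookup c i)) →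
                 relI σ S R c ≡ relI σ T R (map π c)

  LocalIso-mono : ∀ {d e nS nT} {π : Fin nS → Fin nT} {S T A B} → d ≤ e → LocalIso e π S T A B → LocalIso d π S T A B
  LocalIso-mono d≤e iso = record
    { A-into   = A-into
    ; A-onto   = A-onto
    ; nbhd-inj = λ x∈N y∈N → nbhd-inj (InN-mono d≤e x∈N) (InN-mono d≤e y∈N)
    ; funs     = λ f c c∈N → funs f c (InN-mono d≤e ∘ c∈N)
    ; rels     = λ R c c∈N → rels R c (InN-mono d≤e ∘ c∈N)
    }
    where open LocalIso iso

  Similar⇒LocalIso : ∀ {e nS nT} {π : Fin nS → Fin nT} {S T A B} → Similar σ (suc e) π S T A B → LocalIso e π S T A B
  Similar⇒LocalIso {e} {π = π} {S} {T} {A} sim = record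
    { A-into   = A-into
    ; A-onto   = A-onto
    ; nbhd-inj = λ {x} {y} x∈N y∈N → nbhd-inj x y (InN-mono (n≤1+n e) x∈N) (InN-mono (n≤1+n e) y∈N)
    ; funs     = funs
    ; rels     = λ R c c∈N → rels R c (InN-mono (n≤1+n e) ∘ c∈N)
    }
    where
      open Similar sim
      open Enumeration (enumerate A)

      map-evalTs : ∀ {m} (ts : Vec (FOTerm σ (Fin size)) m) → depthTs σ ts ≤ suc e →
                   evalTs σ T (π ∘ elem) ts ≡ map π (evalTs σ S elem ts)
      map-evalTs []       _  = refl
      map-evalTs (t ∷ ts) le =
        cong₂ _∷_ (sym (terms size t (m⊔n≤o⇒m≤o _ _ le) elem elem∈)) (map-evalTs ts (m⊔n≤o⇒n≤o _ _ le))

      funs : ∀ (f : FunSym σ) (c : Vec (Fin _) (fAr σ f)) → (∀ i → InN σ e S A (lookup c i)) →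
             π (funI σ S f c) ≡ funI σ T f (map π c)
      funs f c c∈N with InN⇒terms S A c c∈N
      ... | ts , dts≤e , refl =
        trans (terms size (app f ts) (≤-trans (depthArgs-≤ ts dts≤e) (appDepth-≤ (fAr σ f) e)) elem elem∈)
              (cong (funI σ T f) (map-evalTs ts (m≤n⇒m≤1+n dts≤e)))

  LocalIso⇒Similar : ∀ {nS nT} {π : Fin nS → Fin nT} {S T A B} → LocalIso 0 π S T A B → Similar σ 0 π S T A B
  LocalIso⇒Similar {nS} {π = π} {S} {T} {A} {B} iso = record
    { nbhd-into = into
    ; nbhd-inj  = λ x y → nbhd-inj
    ; nbhd-onto = onto
    ; A-into    = A-into
    ; A-onto    = A-onto
    ; terms     = terms
    ; rels      = rels
    }
    where
      open LocalIso iso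

      noArgs : ∀ {v m} (ρ : Fin v → Fin nS) (ts : Vec (FOTerm σ (Fin v)) m) → depthArgs σ ts ≤ 0 →
               (∀ i → InN σ 0 S A (lookup (evalTs σ S ρ ts) i)) × evalTs σ T (π ∘ ρ) ts ≡ map π (evalTs σ S ρ ts)
      noArgs ρ [] _ = (λ ()) , refl

      terms : ∀ v (t : FOTerm σ (Fin v)) → depthT σ t ≤ 0 → (ρ : Fin v → Fin nS) → (∀ i → ρ i ∈ A) →
              π (evalT σ S ρ t) ≡ evalT σ T (π ∘ ρ) t
      terms v (var x)    _  ρ _ = refl
      terms v (app f ts) le ρ _ with noArgs ρ ts le
      ... | args∈N , args≡ = trans (funs f _ args∈N) (cong (funI σ T f) (sym args≡))

      into : ∀ x → InN σ 0 S A x → InN σ 0 T B (π x)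
      into x (v , t , dt≤0 , ρ , ρ∈A , refl) =
        v , t , dt≤0 , π ∘ ρ , (λ i → A-into _ (ρ∈A i)) , sym (terms v t dt≤0 ρ ρ∈A)

      onto : ∀ y → InN σ 0 T B y → Σ (Fin nS) λ x → InN σ 0 S A x × π x ≡ y
      onto y (v , t , dt≤0 , ρ′ , ρ′∈B , refl) =
        evalT σ S ρ t , (v , t , dt≤0 , ρ , ρ∈A , refl) ,
        trans (terms v t dt≤0 ρ ρ∈A) (evalT-cong T (λ i → proj₂ (proj₂ (A-onto (ρ′ i) (ρ′∈B i)))) t)
        where
          ρ : Fin v → Fin nS
          ρ i = proj₁ (A-onto (ρ′ i) (ρ′∈B i))
          ρ∈A : ∀ i → ρ i ∈ A
          ρ∈A i = proj₁ (proj₂ (A-onto (ρ′ i) (ρ′∈B i)))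

  module Preserved {e nS nT} {π : Fin nS → Fin nT} {S : State σ nS} {T : State σ nT} {A B}
                   (iso : LocalIso e π S T A B) {V : Set} {d j : ℕ} (d+j≤e : d + j ≤ e)
                   (ρ : V → Fin nS) (ρ′ : V → Fin nT) (ρ∈N : ∀ x → InN σ d S A (ρ x)) (ρ′≡πρ : ∀ x → ρ′ x ≡ π (ρ x)) where
    open LocalIso iso

    bounded : ∀ {i x} → i ≤ j → InN σ (d + i) S A x → InN σ e S A x
    bounded i≤j = InN-mono (≤-trans (+-monoʳ-≤ d i≤j) d+j≤e)

    mutual
      evalU-preserved : (u : UTerm σ V) → depthU σ u ≤ j → π (evalU σ S ρ u) ≡ evalU σ T ρ′ u
      evalU-preserved (uvar x)     _  = sym (ρ′≡πρ x)
      evalU-preserved (uapp f ts)  le =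
        trans (funs f (evalUs σ S ρ ts) (bounded le′ ∘ evalUs-InN S A ρ ρ∈N ts))
              (cong (funI σ T f) (sym (evalUs-preserved ts le′)))
        where le′ = ≤-trans (depthUs-≤-depthUArgs ts) le
      evalU-preserved (ite φ t t′) le = begin
        π (if evalF σ S ρ φ then evalU σ S ρ t else evalU σ S ρ t′)
          ≡⟨ if-float π (evalF σ S ρ φ) ⟩
        (if evalF σ S ρ φ then π (evalU σ S ρ t) else π (evalU σ S ρ t′))
          ≡⟨ cong₂ (if evalF σ S ρ φ then_else_) (evalU-preserved t (m⊔n≤o⇒n≤o _ _ le₁)) (evalU-preserved t′ le₂) ⟩
        (if evalF σ S ρ φ then evalU σ T ρ′ t else evalU σ T ρ′ t′)
          ≡⟨ cong (if_then evalU σ T ρ′ t else evalU σ T ρ′ t′) (evalF-preserved φ (m⊔n≤o⇒m≤o _ _ le₁)) ⟩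
        (if evalF σ T ρ′ φ then evalU σ T ρ′ t else evalU σ T ρ′ t′)
          ∎
        where
          open ≡-Reasoning
          le₁ = m⊔n≤o⇒m≤o _ _ le
          le₂ = m⊔n≤o⇒n≤o _ _ le

      evalUs-preserved : ∀ {m} (ts : Vec (UTerm σ V) m) → depthUs σ ts ≤ j → evalUs σ T ρ′ ts ≡ map π (evalUs σ S ρ ts)
      evalUs-preserved []       _  = refl
      evalUs-preserved (t ∷ ts) le =
        cong₂ _∷_ (sym (evalU-preserved t (m⊔n≤o⇒m≤o _ _ le))) (evalUs-preserved ts (m⊔n≤o⇒n≤o _ _ le))

      evalF-preserved : (φ : UForm σ V) → depthF σ φ ≤ j → evalF σ S ρ φ ≡ evalF σ T ρ′ φ
      evalF-preserved (rel R ts) le =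
        trans (rels R (evalUs σ S ρ ts) (bounded le ∘ evalUs-InN S A ρ ρ∈N ts))
              (cong (relI σ T R) (sym (evalUs-preserved ts le)))
      evalF-preserved (eq t t′)  le = begin
        ⌊ evalU σ S ρ t ≟ evalU σ S ρ t′ ⌋
          ≡⟨ ⌊⌋-⇔ (mk⇔ (cong π) (nbhd-inj (bounded le₁ (evalU-InN S A ρ ρ∈N t)) (bounded le₂ (evalU-InN S A ρ ρ∈N t′))))
                  (evalU σ S ρ t ≟ evalU σ S ρ t′) (π (evalU σ S ρ t) ≟ π (evalU σ S ρ t′)) ⟩
        ⌊ π (evalU σ S ρ t) ≟ π (evalU σ S ρ t′) ⌋
          ≡⟨ cong₂ (λ p q → ⌊ p ≟ q ⌋) (evalU-preserved t le₁) (evalU-preserved t′ le₂) ⟩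
        ⌊ evalU σ T ρ′ t ≟ evalU σ T ρ′ t′ ⌋
          ∎
        where
          open ≡-Reasoning
          le₁ = m⊔n≤o⇒m≤o _ _ le
          le₂ = m⊔n≤o⇒n≤o _ _ le
      evalF-preserved tru        _  = refl
      evalF-preserved fls        _  = refl
      evalF-preserved (neg φ)    le = cong not (evalF-preserved φ le)
      evalF-preserved (conj φ ψ) le = cong₂ _∧_ (evalF-preserved φ (m⊔n≤o⇒m≤o _ _ le)) (evalF-preserved ψ (m⊔n≤o⇒n≤o _ _ le))
      evalF-preserved (disj φ ψ) le = cong₂ _∨_ (evalF-preserved φ (m⊔n≤o⇒m≤o _ _ le)) (evalF-preserved ψ (m⊔n≤o⇒n≤o _ _ le))

  newInp-preserved : ∀ {n n′} {π : Fin n → Fin n′} {G : Fin n → Set} → InjectiveOn G π →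
                     (S : State σ n) (T : State σ n′) (δ : AbsMod σ) (a : Vec (Fin n) (modAr σ δ))
                     (r : Fin nIn) (c : Vec (Fin n) (inAr r)) →
                     (∀ i → G (lookup a i)) → (∀ i → G (lookup c i)) →
                     State.inp S r c ≡ State.inp T r (map π c) →
                     newInp σ S δ a r c ≡ newInp σ T δ (map π a) r (map π c)
  newInp-preserved {π = π} inj S T (ins r₀) a r c a∈G c∈G same with r ≟ r₀
  ... | yes refl = cong₂ _∨_ same (⌊⌋-⇔ (mk⇔ (cong (map π)) (map-injectiveOn inj c a c∈G a∈G)) _ _)
  ... | no  _    = same
  newInp-preserved {π = π} inj S T (del r₀) a r c a∈G c∈G same with r ≟ r₀
  ... | yes refl = cong₂ _∧_ same (cong not (⌊⌋-⇔ (mk⇔ (cong (map π)) (map-injectiveOn inj c a c∈G a∈G)) _ _))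
  ... | no  _    = same

  ≤-maxFin : ∀ n (g : Fin n → ℕ) (i : Fin n) → g i ≤ maxFin σ n g
  ≤-maxFin (suc n) g fzero    = m≤m⊔n _ _
  ≤-maxFin (suc n) g (fsuc i) = ≤-trans (≤-maxFin n (g ∘ fsuc) i) (m≤n⊔m _ _)

  module _ (P : Program σ) where
    depthU-t≤progDepth : ∀ δ f → depthU σ (Program.t P δ f) ≤ progDepth σ P
    depthU-t≤progDepth (ins r) f =
      ≤-trans (m≤m⊔n _ _) (≤-trans (≤-maxFin nAuxF _ f) (≤-trans (m≤n⊔m _ _) (≤-maxFin nIn _ r)))
    depthU-t≤progDepth (del r) f =
      ≤-trans (m≤n⊔m _ _) (≤-trans (≤-maxFin nAuxF _ f) (≤-trans (m≤n⊔m _ _) (≤-maxFin nIn _ r)))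

    depthF-φ≤progDepth : ∀ δ R → depthF σ (Program.φ P δ R) ≤ progDepth σ P
    depthF-φ≤progDepth (ins r) R =
      ≤-trans (m≤m⊔n _ _) (≤-trans (≤-maxFin nAuxR _ R) (≤-trans (m≤m⊔n _ _) (≤-maxFin nIn _ r)))
    depthF-φ≤progDepth (del r) R =
      ≤-trans (m≤n⊔m _ _) (≤-trans (≤-maxFin nAuxR _ R) (≤-trans (m≤m⊔n _ _) (≤-maxFin nIn _ r)))

  module Run (P : Program σ) where
    private
      k : ℕ
      k = progDepth σ P

    depthBefore : ℕ → ℕ
    depthBefore zero    = k
    depthBefore (suc j) = suc (depthBefore j) + k

    k≤depthBefore : ∀ j → k ≤ depthBefore j
    k≤depthBefore zero    = ≤-refl
    k≤depthBefore (suc j) = m≤n⇒m≤1+n (m≤n+m k (depthBefore j))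

    appDepth-depthBefore : ∀ {V m j} (ts : Vec (FOTerm σ V) m) → depthArgs σ ts ≤ j →
                           appDepth m (depthBefore (pred j)) + k ≤ depthBefore j
    appDepth-depthBefore {j = j} [] _ = k≤depthBefore j
    appDepth-depthBefore (t ∷ ts) (s≤s _) = ≤-refl

    module _ {n} (S : State σ n) (A : Subset n) (δ : AbsMod σ) (a : Vec (Fin n) (modAr σ δ)) (a∈A : ∀ i → lookup a i ∈ A) where
      private
        S′ : State σ n
        S′ = applyMod σ P (δ , a) S

      mutual
        evalT-applyMod-InN : ∀ {v j} (ρ : Fin v → Fin n) → (∀ i → ρ i ∈ A) → (t : FOTerm σ (Fin v)) → depthT σ t ≤ j →
                             InN σ (depthBefore j) S A (evalT σ S′ ρ t)
        evalT-applyMod-InN ρ ρ∈A (var x) _ = ∈⇒InN (ρ∈A x)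
        evalT-applyMod-InN ρ ρ∈A (app (biF f) ts) le =
          InN-mono (≤-trans (m≤m+n _ k) (appDepth-depthBefore ts le))
                   (funI-InN S A (biF f) (evalTs σ S′ ρ ts) (evalTs-applyMod-InN ρ ρ∈A ts (depthTs-≤-pred ts le)))
        evalT-applyMod-InN {j = j} ρ ρ∈A (app (auxF f) ts) le =
          InN-mono (≤-trans (+-monoʳ-≤ _ (depthU-t≤progDepth P δ f)) (appDepth-depthBefore ts le))
                   (evalU-InN S A [ lookup a , lookup c ] env∈N (Program.t P δ f))
          where
            c = evalTs σ S′ ρ ts
            env∈N : ∀ x → InN σ (appDepth (auxFAr f) (depthBefore (pred j))) S A ([ lookup a , lookup c ] x)
            env∈N (inj₁ i) = ∈⇒InN (a∈A i)
            env∈N (inj₂ i) = InN-appDepth c (evalTs-applyMod-InN ρ ρ∈A ts (depthTs-≤-pred ts le)) i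

        evalTs-applyMod-InN : ∀ {v j m} (ρ : Fin v → Fin n) → (∀ i → ρ i ∈ A) → (ts : Vec (FOTerm σ (Fin v)) m) →
                              depthTs σ ts ≤ j → ∀ i → InN σ (depthBefore j) S A (lookup (evalTs σ S′ ρ ts) i)
        evalTs-applyMod-InN ρ ρ∈A (t ∷ ts) le fzero    = evalT-applyMod-InN ρ ρ∈A t (m⊔n≤o⇒m≤o _ _ le)
        evalTs-applyMod-InN ρ ρ∈A (t ∷ ts) le (fsuc i) = evalTs-applyMod-InN ρ ρ∈A ts (m⊔n≤o⇒n≤o _ _ le) i

      applyMod-InN : ∀ {j x} → InN σ j S′ A x → InN σ (depthBefore j) S A x
      applyMod-InN {j} (v , t , dt≤j , ρ , ρ∈A , refl) = evalT-applyMod-InN ρ ρ∈A t dt≤j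

    LocalIso-applyMod : ∀ {j nS nT} {π : Fin nS → Fin nT} {S : State σ nS} {T : State σ nT} {A B}
                        (δ : AbsMod σ) (a : Vec (Fin nS) (modAr σ δ)) → (∀ i → lookup a i ∈ A) →
                        LocalIso (depthBefore j + k) π S T A B →
                        LocalIso j π (applyMod σ P (δ , a) S) (applyMod σ P (δ , map π a) T) A B
    LocalIso-applyMod {j} {nS} {π = π} {S} {T} {A} δ a a∈A iso = record
      { A-into   = A-into
      ; A-onto   = A-onto
      ; nbhd-inj = λ x∈N y∈N → nbhd-inj (old x∈N) (old y∈N)
      ; funs     = funs′
      ; rels     = rels′
      }
      where
        open LocalIso iso
        S′ = applyMod σ P (δ , a) S
        T′ = applyMod σ P (δ , map π a) T

        old : ∀ {x} → InN σ j S′ A x → InN σ (depthBefore j + k) S A x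
        old = InN-mono (m≤m+n _ k) ∘ applyMod-InN S A δ a a∈A

        env∈N : ∀ {m} (c : Vec (Fin nS) m) → (∀ i → InN σ j S′ A (lookup c i)) →
                ∀ x → InN σ (depthBefore j) S A ([ lookup a , lookup c ] x)
        env∈N c c∈N (inj₁ i) = ∈⇒InN (a∈A i)
        env∈N c c∈N (inj₂ i) = applyMod-InN S A δ a a∈A (c∈N i)

        env≡ : ∀ {m} (c : Vec (Fin nS) m) → ∀ x → [ lookup (map π a) , lookup (map π c) ] x ≡ π ([ lookup a , lookup c ] x)
        env≡ c (inj₁ i) = lookup-map i π a
        env≡ c (inj₂ i) = lookup-map i π c

        module Update {m} (c : Vec (Fin nS) m) (c∈N : ∀ i → InN σ j S′ A (lookup c i)) =
          Preserved iso ≤-refl [ lookup a , lookup c ] [ lookup (map π a) , lookup (map π c) ] (env∈N c c∈N) (env≡ c)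

        funs′ : ∀ (f : FunSym σ) (c : Vec (Fin nS) (fAr σ f)) → (∀ i → InN σ j S′ A (lookup c i)) →
                π (funI σ S′ f c) ≡ funI σ T′ f (map π c)
        funs′ (biF f) c c∈N = funs (biF f) c (old ∘ c∈N)
        funs′ (auxF f) c c∈N = Update.evalU-preserved c c∈N (Program.t P δ f) (depthU-t≤progDepth P δ f)

        rels′ : ∀ (R : RelSym σ) (c : Vec (Fin nS) (rAr σ R)) → (∀ i → InN σ j S′ A (lookup c i)) →
                relI σ S′ R c ≡ relI σ T′ R (map π c)
        rels′ (inR r)  c c∈N =
          newInp-preserved nbhd-inj S T δ a r c (λ i → ∈⇒InN (a∈A i)) (old ∘ c∈N) (rels (inR r) c (old ∘ c∈N))
        rels′ (auxR R) c c∈N = Update.evalF-preserved c c∈N (Program.φ P δ R) (depthF-φ≤progDepth P δ R)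
        rels′ (biR R)  c c∈N = rels (biR R) c (old ∘ c∈N)

    requiredDepth : ℕ → ℕ
    requiredDepth zero    = 0
    requiredDepth (suc l) = depthBefore (requiredDepth l) + k

    LocalIso-run : ∀ {nS nT} {π : Fin nS → Fin nT} {A B} l (α : List (Mod σ nS)) (S : State σ nS) (T : State σ nT) →
                   length α ≤ l → OnSet σ A α → LocalIso (requiredDepth l) π S T A B →
                   LocalIso 0 π (run σ P α S) (run σ P (Data.List.map (mapMod σ π) α) T) A B
    LocalIso-run l       []            S T _         _           iso = LocalIso-mono z≤n iso
    LocalIso-run (suc l) ((δ , a) ∷ α) S T (s≤s |α|≤l) (a∈A ∷ α-on) iso =
      LocalIso-run l α _ _ |α|≤l α-on (LocalIso-applyMod δ a a∈A iso)

lemma5p5 : (σ : DynSchema) (P : Program σ) (k l : ℕ) → progDepth σ P ≡ k →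
    {nS nT : ℕ} (S : State σ nS) (T : State σ nT) (A : Subset nS) (B : Subset nT) →
    Σ ℕ λ m → (π : Fin nS → Fin nT) → Similar σ m π S T A B →
      (α : List (Mod σ nS)) (β : List (Mod σ nT)) →
      OnSet σ A α → OnSet σ B β → Respecting σ π α β →
      length α ≤ l → length β ≤ l →
      Similar σ 0 π (run σ P α S) (run σ P β T) A B
lemma5p5 σ P k l refl S T A B =
  suc (requiredDepth l) , λ { π similar α _ α-on _ refl |α|≤l _ →
    LocalIso⇒Similar σ (LocalIso-run l α S T |α|≤l α-on (Similar⇒LocalIso σ similar)) }
  where open Run σ P
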